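{- Let $G=(V,E)$ be a graph and $v_0\in V$. The edge coloring produced by the BFS-based procedure described below (started at $v_0$) is a valid edge $2$-coloring of the edges it colors, i.e., every vertex of $G$ is incident to edges of at most $2$ distinct colors. The procedure: Let $Q_1\leftarrow\{v_0\}$, $Q_2\leftarrow\emptyset$, mark $v_0$ visited, and set the integer $c\leftarrow 1$. Repeat: (2) color every uncolored edge $(v_i,v_j)$ incident to some $v_i\in Q_1$ with color $c$; (3) while doing so, add every unvisited such neighbor $v_j$ to $Q_2$ and (4) mark these $v_j$ visited; (5) consider the subgraph formed by all edges currently colored $c$, and recolor each connected component of this subgraph with a new color, obtained each time by incrementing $c$; (6) set $c\leftarrow c+1$, $Q_1\leftarrow Q_2$, $Q_2\leftarrow\emptyset$; (7) if $Q_1=\emptyset$ stop, otherwise go back to step (2).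
   Context: An edge coloring of a graph $G=(V,E)$ is a map $\sigma$ from (a subset of) $E$ to the positive integers. For a vertex $v$, its color class is $cc(v)=\{\sigma((v,v')) : (v,v')\in E \text{ colored}\}$. An edge $q$-coloring is an edge coloring in which $|cc(v)|\le q$ for every vertex $v$; in particular an edge $2$-coloring is one where every vertex is incident to edges of at most two distinct colors. -}

module Defs where

open import Data.Nat using (ℕ; zero; suc; _+_; _≡ᵇ_; _<ᵇ_)
open import Data.Bool using (Bool; true; false; _∧_; _∨_; not; if_then_else_)
open import Data.Fin using (Fin; toℕ)
import Data.Fin as F
import Data.Nat as N
open import Data.List using (List; []; _∷_; allFin; map; filterᵇ; deduplicate)
open import Data.Bool.ListAction using (any)
open import Data.Nat.ListAction using (sum)
open import Relation.Nullary.Decidable using (⌊_⌋)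
open import Relation.Binary.PropositionalEquality using (_≡_)

record Graph (n : ℕ) : Set where
  field
    adj        : Fin n → Fin n → Bool
    adj-sym    : ∀ i j → adj i j ≡ adj j i
    adj-irrefl : ∀ i → adj i i ≡ false
open Graph public

-- A (partial) edge coloring: col i j is the color of edge {i,j};
-- the value 0 means "uncolored" (colors are positive integers).
Coloring : ℕ → Set
Coloring n = Fin n → Fin n → ℕ

_==F_ : ∀ {n} → Fin n → Fin n → Bool
i ==F j = ⌊ i F.≟ j ⌋

anyFin : ∀ {n} → (Fin n → Bool) → Bool
anyFin {n} p = any p (allFin n)

countFin : ∀ {n} → (Fin n → Bool) → ℕ
countFin {n} p = sum (map (λ x → if p x then 1 else 0) (allFin n))

firstIn : ∀ {n} → List (Fin n) → (Fin n → Bool) → Fin n → Fin n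
firstIn [] p d = d
firstIn (x ∷ xs) p d = if p x then x else firstIn xs p d

first : ∀ {n} → (Fin n → Bool) → Fin n → Fin n
first {n} p d = firstIn (allFin n) p d

record State (n : ℕ) : Set where
  constructor st
  field
    col     : Coloring n
    visited : Fin n → Bool
    Q1      : Fin n → Bool
    c       : ℕ
open State public

step : ∀ {n} → Graph n → State n → State n
step {n} G (st col vis q1 c) = st col₃ vis' q2 c'
  where
  A = adj G
  col₂ : Coloring n
  col₂ i j = if A i j ∧ (col i j ≡ᵇ 0) ∧ (q1 i ∨ q1 j) then c else col i j
  q2 : Fin n → Bool
  q2 j = not (vis j) ∧ anyFin (λ i → q1 i ∧ A i j ∧ (col i j ≡ᵇ 0))
  vis' : Fin n → Bool
  vis' j = vis j ∨ q2 j
  cEdge : Fin n → Fin n → Bool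
  cEdge i j = A i j ∧ (col₂ i j ≡ᵇ c)
  reach : ℕ → Fin n → Fin n → Bool
  reach zero v u = v ==F u
  reach (suc k) v u = reach k v u ∨ anyFin (λ w → reach k v w ∧ cEdge w u)
  -- representative of a component: its least vertex
  rep : Fin n → Fin n
  rep v = first (reach n v) v
  touched : Fin n → Bool
  touched u = anyFin (cEdge u)
  isRep : Fin n → Bool
  isRep u = touched u ∧ (rep u ==F u)
  -- components are numbered 0,1,...,k-1 by their representatives
  rank : Fin n → ℕ
  rank r = countFin (λ u → isRep u ∧ (toℕ u <ᵇ toℕ r))
  k : ℕ
  k = countFin isRep
  -- component number m gets the new color c+1+m (c incremented per component)
  col₃ : Coloring n
  col₃ i j = if cEdge i j then c + 1 + rank (rep i) else col₂ i j
  -- after the k increments of step (5), step (6) increments c once more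
  c' : ℕ
  c' = c + k + 1

-- Repeat until Q1 = ∅ (with fuel; n+1 rounds always suffice since every
-- non-final round visits at least one new vertex).
run : ∀ {n} → ℕ → Graph n → State n → State n
run zero G s = s
run (suc f) G s = if anyFin (Q1 s) then run f G (step G s) else s

initState : ∀ {n} → Fin n → State n
initState v₀ = st (λ _ _ → 0) (λ v → v ==F v₀) (λ v → v ==F v₀) 1

bfsColoring : ∀ {n} → Graph n → Fin n → Coloring n
bfsColoring {n} G v₀ = col (run (suc n) G (initState v₀))

ccList : ∀ {n} → Graph n → Coloring n → Fin n → List ℕ
ccList {n} G σ v =
  map (σ v) (filterᵇ (λ w → adj G v w ∧ not (σ v w ≡ᵇ 0)) (allFin n))

ccSize : ∀ {n} → Graph n → Coloring n → Fin n → ℕ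
ccSize G σ v = Data.List.length (deduplicate N._≟_ (ccList G σ v))

IsEdge2Coloring : ∀ {n} → Graph n → Coloring n → Set
IsEdge2Coloring G σ = ∀ v → ccSize G σ v N.≤ 2

module Submission where

-- At any moment each vertex v is in one of three phases:
--   unseen   : not visited, not in Q1, no edge at v coloured (in either
--              orientation of the colouring matrix);
--   frontier : visited, in Q1, all coloured edges at v share one colour a;
--   settled  : visited, not in Q1, every edge at v coloured, from {a, b}.
-- One round first paints each uncoloured edge touching Q1 with the counter
-- c, then replaces c, on row v of the colouring, by one fresh non-zero
-- colour N_v (the colour of v's component); i.e. row v becomes
-- relabel c N_v ∘ paint.  Since c ≠ 0 this never colours an uncoloured edge
-- and maps every colour class to a colour class, so phases advance
-- unseen → (unseen or frontier) → settled → settled.  The invariant thus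
-- survives any number of rounds, and in each phase the colours at v lie in
-- a two-element set, which bounds |cc(v)| by 2.

open import Defs
open import Data.Nat using (ℕ; zero; suc; _+_; _≤_; z≤n; s≤s; _≡ᵇ_)
import Data.Nat as N
open import Data.Nat.Properties using (≡⇒≡ᵇ; m+1+n≢0; m+n≡0⇒m≡0)
open import Data.Bool using (Bool; true; false; _∧_; _∨_; not; T; if_then_else_)
open import Data.Bool.Properties using (T-≡; T-∧)
open import Data.Fin using (Fin)
open import Data.List using (List; []; _∷_; allFin; length)
import Data.List.Relation.Unary.All as All
open import Data.List.Relation.Unary.All using (All; _∷_)
open import Data.List.Relation.Unary.All.Properties using (map⁺; all-filter; deduplicate⁺)
import Data.List.Relation.Unary.Any as Any
open import Data.List.Relation.Unary.Any.Properties using (any⁺)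
open import Data.List.Relation.Unary.AllPairs using (AllPairs; _∷_)
open import Data.List.Relation.Unary.Unique.DecPropositional.Properties using (deduplicate-!)
open import Data.List.Membership.Propositional.Properties using (∈-allFin)
open import Data.Sum using (_⊎_; inj₁; inj₂)
open import Data.Product using (Σ; _×_; _,_; proj₁; proj₂)
open import Data.Empty using (⊥; ⊥-elim)
open import Function using (_∘_)
open import Function.Bundles using (Equivalence)
open import Relation.Nullary using (yes; no)
open import Relation.Binary.PropositionalEquality using (_≡_; _≢_; refl; sym; trans; cong; subst)

OneOf : ℕ → ℕ → ℕ → Set
OneOf a b x = x ≡ a ⊎ x ≡ b

OneOf-map : ∀ (f : ℕ → ℕ) {a b x} → OneOf a b x → OneOf (f a) (f b) (f x)
OneOf-map f (inj₁ refl) = inj₁ refl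
OneOf-map f (inj₂ refl) = inj₂ refl

distinct-in-pair : ∀ a b (xs : List ℕ) → All (OneOf a b) xs →
  AllPairs _≢_ xs → length xs ≤ 2
distinct-in-pair _ _ [] _ _ = z≤n
distinct-in-pair _ _ (_ ∷ []) _ _ = s≤s z≤n
distinct-in-pair _ _ (_ ∷ _ ∷ []) _ _ = s≤s (s≤s z≤n)
distinct-in-pair a b (x ∷ y ∷ z ∷ _) (px ∷ py ∷ pz ∷ _) ((x≢y ∷ x≢z ∷ _) ∷ (y≢z ∷ _) ∷ _) =
  ⊥-elim (clash px py pz)
  where
  clash : OneOf a b x → OneOf a b y → OneOf a b z → ⊥
  clash (inj₁ p) (inj₁ q) _ = x≢y (trans p (sym q))
  clash (inj₂ p) (inj₂ q) _ = x≢y (trans p (sym q))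
  clash (inj₁ p) _ (inj₁ q) = x≢z (trans p (sym q))
  clash (inj₂ p) _ (inj₂ q) = x≢z (trans p (sym q))
  clash _ (inj₁ p) (inj₁ q) = y≢z (trans p (sym q))
  clash _ (inj₂ p) (inj₂ q) = y≢z (trans p (sym q))

TwoColoursAt : ∀ {n} → Graph n → Coloring n → Fin n → Set
TwoColoursAt G σ v = Σ ℕ λ a → Σ ℕ λ b →
  ∀ w → adj G v w ≡ true → σ v w ≢ 0 → OneOf a b (σ v w)

ccSize≤2 : ∀ {n} (G : Graph n) (σ : Coloring n) (v : Fin n) →
  TwoColoursAt G σ v → ccSize G σ v ≤ 2
ccSize≤2 {n} G σ v (a , b , among) =
  distinct-in-pair a b _
    (deduplicate⁺ N._≟_ (map⁺ (All.map listed (all-filter _ (allFin n)))))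
    (deduplicate-! N._≟_ _)
  where
  listed : ∀ {w} → T (adj G v w ∧ not (σ v w ≡ᵇ 0)) → OneOf a b (σ v w)
  listed {w} t with Equivalence.to T-∧ t
  ... | edge , coloured =
    among w (Equivalence.to T-≡ edge) (λ e → subst (T ∘ not ∘ (_≡ᵇ 0)) e coloured)

∨-introˡ : ∀ {x} y → x ≡ true → x ∨ y ≡ true
∨-introˡ y refl = refl

∨-introʳ : ∀ x {y} → y ≡ true → x ∨ y ≡ true
∨-introʳ false refl = refl
∨-introʳ true refl = refl

∨-false : ∀ {x y} → x ≡ false → y ≡ false → x ∨ y ≡ false
∨-false refl refl = refl

-- case analysis on a boolean that keeps the boolean itself in the goal
true-or-false : ∀ b → b ≡ true ⊎ b ≡ false
true-or-false true = inj₁ refl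
true-or-false false = inj₂ refl

-- steps (3),(4) on the marks of a vertex v, where y says whether v is reached
mark-unvisited : ∀ {x} y → x ≡ false → x ∨ (not x ∧ y) ≡ y × not x ∧ y ≡ y
mark-unvisited y refl = refl , refl

mark-visited : ∀ {x} y → x ≡ true → x ∨ (not x ∧ y) ≡ true × not x ∧ y ≡ false
mark-visited y refl = refl , refl

paint : Bool → ℕ → Bool → ℕ → ℕ
paint e x q c = if e ∧ (x ≡ᵇ 0) ∧ q then c else x

paint-coloured : ∀ {e x q c} → x ≢ 0 → paint e x q c ≡ x
paint-coloured {x = zero} x≢0 = ⊥-elim (x≢0 refl)
paint-coloured {e = false} {x = suc x} _ = refl
paint-coloured {e = true} {x = suc x} _ = refl

paint-fresh : ∀ {e x q c} → e ≡ true → x ≡ 0 → q ≡ true → paint e x q c ≡ c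
paint-fresh refl refl refl = refl

paint-idle : ∀ {e x q c} → x ≡ 0 → q ≡ false → paint e x q c ≡ 0
paint-idle {false} refl refl = refl
paint-idle {true} refl refl = refl

relabel : ℕ → ℕ → ℕ → ℕ
relabel c N x = if x ≡ᵇ c then N else x

m+1+r≢0 : ∀ m r → m + 1 + r ≢ 0
m+1+r≢0 m r e = m+1+n≢0 m (m+n≡0⇒m≡0 (m + 1) e)

relabel-uncoloured : ∀ {c} N → c ≢ 0 → relabel c N 0 ≡ 0
relabel-uncoloured {zero} N c≢0 = ⊥-elim (c≢0 refl)
relabel-uncoloured {suc c} N _ = refl

relabel-current : ∀ c N → relabel c N c ≡ N
relabel-current c N rewrite Equivalence.to T-≡ (≡⇒≡ᵇ c c refl) = refl

relabel-coloured : ∀ c {N x} → N ≢ 0 → x ≢ 0 → relabel c N x ≢ 0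
relabel-coloured c {x = x} N≢0 x≢0 with x ≡ᵇ c
... | true = N≢0
... | false = x≢0

data Phase {n} (G : Graph n) (s : State n) (v : Fin n) : Set where
  unseen : visited s v ≡ false → Q1 s v ≡ false →
    (∀ w → adj G v w ≡ true → col s v w ≡ 0 × col s w v ≡ 0) → Phase G s v
  frontier : visited s v ≡ true → Q1 s v ≡ true → (a : ℕ) →
    (∀ w → adj G v w ≡ true → col s v w ≡ 0 ⊎ col s v w ≡ a) → Phase G s v
  settled : visited s v ≡ true → Q1 s v ≡ false → (a b : ℕ) →
    (∀ w → adj G v w ≡ true → col s v w ≢ 0 × OneOf a b (col s v w)) → Phase G s v

phase-two-colours : ∀ {n} {G : Graph n} {s : State n} {v : Fin n} →
  Phase G s v → TwoColoursAt G (col s) v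
phase-two-colours (unseen _ _ blank) =
  0 , 0 , λ w vw coloured → ⊥-elim (coloured (proj₁ (blank w vw)))
phase-two-colours (frontier _ _ a row) = a , a , λ w vw coloured → single (row w vw) coloured
  where
  single : ∀ {x} → x ≡ 0 ⊎ x ≡ a → x ≢ 0 → OneOf a a x
  single (inj₁ x≡0) coloured = ⊥-elim (coloured x≡0)
  single (inj₂ x≡a) _ = inj₁ x≡a
phase-two-colours (settled _ _ a b row) = a , b , λ w vw _ → proj₂ (row w vw)

module Round {n} (G : Graph n) (s : State n) (c≢0 : c s ≢ 0) where

  s′ : State n
  s′ = step G s

  painted : Fin n → Fin n → ℕ
  painted i j = paint (adj G i j) (col s i j) (Q1 s i ∨ Q1 s j) (c s)

  reached : Fin n → Bool
  reached v = anyFin (λ i → Q1 s i ∧ adj G i v ∧ (col s i v ≡ᵇ 0))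

  reached-by : ∀ {v} w → Q1 s w ≡ true → adj G w v ≡ true → col s w v ≡ 0 →
    reached v ≡ true
  reached-by {v} w qw wv blank =
    Equivalence.to T-≡ (any⁺ _ (Any.map witness (∈-allFin w)))
    where
    witness : ∀ {i} → w ≡ i → T (Q1 s i ∧ adj G i v ∧ (col s i v ≡ᵇ 0))
    witness refl rewrite qw | wv | blank = _

  -- step (5) on row v: colour c becomes one fresh colour c + 1 + r, with r
  -- depending on v only (it numbers the component containing v)
  rows-relabelled : ∀ v → Σ ℕ λ N → N ≢ 0 ×
    (∀ w → adj G v w ≡ true → col s′ v w ≡ relabel (c s) N (painted v w))
  rows-relabelled v = _ , m+1+r≢0 (c s) _ , λ w vw → relabel-edge (painted v w) vw
    where
    relabel-edge : ∀ {e c N} x → e ≡ true → (if e ∧ (x ≡ᵇ c) then N else x) ≡ relabel c N x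
    relabel-edge x refl = refl

  fresh : Fin n → ℕ
  fresh v = proj₁ (rows-relabelled v)

  fresh≢0 : ∀ v → fresh v ≢ 0
  fresh≢0 v = proj₁ (proj₂ (rows-relabelled v))

  recolour : Fin n → ℕ → ℕ
  recolour v = relabel (c s) (fresh v)

  row-after-round : ∀ {v w} → adj G v w ≡ true → col s′ v w ≡ recolour v (painted v w)
  row-after-round {v} {w} = proj₂ (proj₂ (rows-relabelled v)) w

  edge-idle : ∀ {i j} → adj G i j ≡ true → col s i j ≡ 0 →
    Q1 s i ≡ false → Q1 s j ≡ false → col s′ i j ≡ 0
  edge-idle {i} {j} ij blank qi qj = trans (row-after-round ij)
    (trans (cong (recolour i) (paint-idle {adj G i j} {c = c s} blank (∨-false qi qj)))
           (relabel-uncoloured (fresh i) c≢0))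

  edge-fresh : ∀ {i j} → adj G i j ≡ true → col s i j ≡ 0 →
    Q1 s i ∨ Q1 s j ≡ true → col s′ i j ≡ fresh i
  edge-fresh {i} ij blank q = trans (row-after-round ij)
    (trans (cong (recolour i) (paint-fresh {c = c s} ij blank q))
           (relabel-current (c s) (fresh i)))

  edge-kept : ∀ {i j} → adj G i j ≡ true → col s i j ≢ 0 → col s′ i j ≡ recolour i (col s i j)
  edge-kept {i} {j} ij coloured = trans (row-after-round ij)
    (cong (recolour i) (paint-coloured {adj G i j} {q = Q1 s i ∨ Q1 s j} {c s} coloured))

  edge-kept≢0 : ∀ {i j} → adj G i j ≡ true → col s i j ≢ 0 → col s′ i j ≢ 0
  edge-kept≢0 {i} ij coloured e =
    relabel-coloured (c s) (fresh≢0 i) coloured (trans (sym (edge-kept ij coloured)) e)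

  unseen-round : ∀ {v} → visited s v ≡ false → Q1 s v ≡ false →
    (∀ w → adj G v w ≡ true → col s v w ≡ 0 × col s w v ≡ 0) → Phase G s′ v
  unseen-round {v} unvisited qv blank with mark-unvisited (reached v) unvisited | true-or-false (reached v)
  ... | visited′ , q′ | inj₂ r = unseen (trans visited′ r) (trans q′ r) λ w vw →
    let wv = trans (adj-sym G w v) vw
        qw = not-in-Q1 w wv (proj₂ (blank w vw))
    in edge-idle vw (proj₁ (blank w vw)) qv qw , edge-idle wv (proj₂ (blank w vw)) qw qv
    where
    not-in-Q1 : ∀ w → adj G w v ≡ true → col s w v ≡ 0 → Q1 s w ≡ false
    not-in-Q1 w wv blank′ with true-or-false (Q1 s w)
    ... | inj₂ qw = qw
    ... | inj₁ qw with trans (sym (reached-by w qw wv blank′)) r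
    ...   | ()
  ... | visited′ , q′ | inj₁ r = frontier (trans visited′ r) (trans q′ r) (fresh v) row′
    where
    row′ : ∀ w → adj G v w ≡ true → col s′ v w ≡ 0 ⊎ col s′ v w ≡ fresh v
    row′ w vw with true-or-false (Q1 s w)
    ... | inj₁ qw = inj₂ (edge-fresh vw (proj₁ (blank w vw)) (∨-introʳ (Q1 s v) qw))
    ... | inj₂ qw = inj₁ (edge-idle vw (proj₁ (blank w vw)) qv qw)

  frontier-round : ∀ {v} → visited s v ≡ true → Q1 s v ≡ true → (a : ℕ) →
    (∀ w → adj G v w ≡ true → col s v w ≡ 0 ⊎ col s v w ≡ a) → Phase G s′ v
  frontier-round {v} seen qv a row with mark-visited (reached v) seen
  ... | visited′ , q′ = settled visited′ q′ (recolour v a) (fresh v) row′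
    where
    row′ : ∀ w → adj G v w ≡ true → col s′ v w ≢ 0 × OneOf (recolour v a) (fresh v) (col s′ v w)
    row′ w vw with col s v w N.≟ 0 | row w vw
    ... | yes blank | _ =
      let e = edge-fresh vw blank (∨-introˡ (Q1 s w) qv)
      in (λ z → fresh≢0 v (trans (sym e) z)) , inj₂ e
    ... | no coloured | inj₁ blank = ⊥-elim (coloured blank)
    ... | no coloured | inj₂ x≡a =
      edge-kept≢0 vw coloured , inj₁ (trans (edge-kept vw coloured) (cong (recolour v) x≡a))

  settled-round : ∀ {v} → visited s v ≡ true → Q1 s v ≡ false → (a b : ℕ) →
    (∀ w → adj G v w ≡ true → col s v w ≢ 0 × OneOf a b (col s v w)) → Phase G s′ v
  settled-round {v} seen _ a b row with mark-visited (reached v) seen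
  ... | visited′ , q′ = settled visited′ q′ (recolour v a) (recolour v b) λ w vw →
    let coloured , one = row w vw
    in edge-kept≢0 vw coloured ,
       subst (OneOf _ _) (sym (edge-kept vw coloured)) (OneOf-map (recolour v) one)

  phase-round : ∀ {v} → Phase G s v → Phase G s′ v
  phase-round (unseen unvisited qv blank) = unseen-round unvisited qv blank
  phase-round (frontier seen qv a row) = frontier-round seen qv a row
  phase-round (settled seen qv a b row) = settled-round seen qv a b row

record Invariant {n} (G : Graph n) (s : State n) : Set where
  field
    counter≢0 : c s ≢ 0
    phase : ∀ v → Phase G s v
open Invariant

step-preserves : ∀ {n} (G : Graph n) (s : State n) → Invariant G s → Invariant G (step G s)
step-preserves G s I = record
  { counter≢0 = m+1+n≢0 _
  ; phase = λ v → Round.phase-round G s (counter≢0 I) (phase I v)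
  }

run-preserves : ∀ {n} (fuel : ℕ) (G : Graph n) (s : State n) →
  Invariant G s → Invariant G (run fuel G s)
run-preserves zero G s I = I
run-preserves (suc fuel) G s I with anyFin (Q1 s)
... | true = run-preserves fuel G (step G s) (step-preserves G s I)
... | false = I

initial-invariant : ∀ {n} (G : Graph n) (v₀ : Fin n) → Invariant G (initState v₀)
initial-invariant G v₀ = record { counter≢0 = λ () ; phase = start }
  where
  start : ∀ v → Phase G (initState v₀) v
  start v with true-or-false (v ==F v₀)
  ... | inj₁ isRoot = frontier isRoot isRoot 0 λ _ _ → inj₁ refl
  ... | inj₂ notRoot = unseen notRoot notRoot λ _ _ → refl , refl

theorem1 : (n : ℕ) (G : Graph n) (v₀ : Fin n) → IsEdge2Coloring G (bfsColoring G v₀)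
theorem1 n G v₀ v =
  ccSize≤2 G (bfsColoring G v₀) v (phase-two-colours (phase final v))
  where
  final : Invariant G (run (suc n) G (initState v₀))
  final = run-preserves (suc n) G (initState v₀) (initial-invariant G v₀)
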